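{- For $n=2$, there is a polytope $P=\{z\in\mathbb{R}^2: Bz\leq d\}$ with a pair of vertices $v^{(1)},v^{(2)}$ such that there is no feasible maximal sign-compatible circuit walk from $v^{(1)}$ to $v^{(2)}$. In particular, there is no feasible maximal sign-compatible edge walk from $v^{(1)}$ to $v^{(2)}$.
   Context: A circuit of $B$ is a vector $g\neq0$ such that $Bg$ has inclusion-minimal support in $\{Bz: z\neq0\}$, normalized to coprime integer components. A circuit walk from vertex $v^{(1)}$ to vertex $v^{(2)}$ is a finite sequence $v^{(1)}=y^{(0)},\dots,y^{(k)}=v^{(2)}$ with $y^{(i+1)}-y^{(i)}=\alpha_ig^i$, $g^i$ circuits, $\alpha_i>0$. It is feasible if all $y^{(i)}\in P$; maximal if $y^{(i)}+\alpha g^i\notin P$ for all $\alpha>\alpha_i$ and all $i$; an edge walk if consecutive $y^{(i)}$ are adjacent vertices of $P$; sign-compatible if $(Bg^i)_l(Bg^j)_l\geq0$ and $(Bg^i)_l(B(v^{(2)}-v^{(1)}))_l\geq0$ for all $i,j,l$.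
   Formalization: B and d have rational entries; the points z, including the vertices and those in the circuit definition, and the step lengths $\alpha_i$ and $\alpha$ are taken in ℚ rather than ℝ. -}

module Defs where

open import Data.Nat using (ℕ; zero; suc)
open import Data.Nat.Divisibility using (_∣_)
open import Data.Integer as ℤ using (ℤ)
open import Data.Rational using (ℚ; 0ℚ; 1ℚ; _+_; _*_; _-_; _≤_; _<_; ∣_∣; _/_)
open import Data.Fin using (Fin; zero; suc)
open import Data.List using (List; []; _∷_)
open import Data.List.Membership.Propositional using (_∈_)
open import Data.Product using (Σ; ∃; _×_; _,_; proj₁; proj₂)
open import Data.Unit using (⊤)
open import Relation.Nullary using (¬_)
open import Relation.Binary.PropositionalEquality using (_≡_; _≢_)

Point : ℕ → Set
Point n = Fin n → ℚ

Matrix : ℕ → ℕ → Set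
Matrix m n = Fin m → Fin n → ℚ

Σᶠ : ∀ {n} → (Fin n → ℚ) → ℚ
Σᶠ {zero}  f = 0ℚ
Σᶠ {suc n} f = f zero + Σᶠ (λ i → f (suc i))

_·_ : ∀ {n} → Point n → Point n → ℚ
x · y = Σᶠ (λ i → x i * y i)

_⊛_ : ∀ {m n} → Matrix m n → Point n → Point m
(B ⊛ z) l = Σᶠ (λ i → B l i * z i)

_⊕_ : ∀ {n} → Point n → Point n → Point n
(x ⊕ y) i = x i + y i

_⊖_ : ∀ {n} → Point n → Point n → Point n
(x ⊖ y) i = x i - y i

_⊙_ : ∀ {n} → ℚ → Point n → Point n
(a ⊙ x) i = a * x i

_≈_ : ∀ {n} → Point n → Point n → Set
x ≈ y = ∀ i → x i ≡ y i

toℚᵛ : ∀ {n} → (Fin n → ℤ) → Point n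
toℚᵛ g i = g i / 1

InP : ∀ {m n} → Matrix m n → Point m → Point n → Set
InP B d z = ∀ l → (B ⊛ z) l ≤ d l

Bounded : ∀ {m n} → Matrix m n → Point m → Set
Bounded {n = n} B d = ∃ λ (M : ℚ) → ∀ (z : Point n) → InP B d z → ∀ i → ∣ z i ∣ ≤ M

IsVertex : ∀ {m n} → Matrix m n → Point m → Point n → Set
IsVertex {n = n} B d v =
  InP B d v ×
  (∀ (x y : Point n) (λ′ : ℚ) → InP B d x → InP B d y → 0ℚ < λ′ → λ′ < 1ℚ →
     v ≈ ((λ′ ⊙ x) ⊕ ((1ℚ - λ′) ⊙ y)) → x ≈ v)

OnSegment : ∀ {n} → Point n → Point n → Point n → Set
OnSegment u w z = ∃ λ (t : ℚ) → 0ℚ ≤ t × t ≤ 1ℚ × z ≈ (u ⊕ (t ⊙ (w ⊖ u)))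

-- u, w adjacent vertices: distinct vertices whose segment is a face of P
Adjacent : ∀ {m n} → Matrix m n → Point m → Point n → Point n → Set
Adjacent {n = n} B d u w =
  IsVertex B d u × IsVertex B d w × ¬ (u ≈ w) ×
  (∃ λ (c : Point n) → ∃ λ (δ : ℚ) →
     (∀ z → InP B d z → c · z ≤ δ) × c · u ≡ δ × c · w ≡ δ ×
     (∀ z → InP B d z → c · z ≡ δ → OnSegment u w z))

NonZeroℚ : ∀ {n} → Point n → Set
NonZeroℚ z = ¬ (∀ i → z i ≡ 0ℚ)

NonZeroℤ : ∀ {n} → (Fin n → ℤ) → Set
NonZeroℤ g = ¬ (∀ i → g i ≡ ℤ.0ℤ)

CoprimeComponents : ∀ {n} → (Fin n → ℤ) → Set
CoprimeComponents g = ∀ (k : ℕ) → (∀ i → k ∣ (ℤ.∣_∣ (g i))) → k ≡ 1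

-- circuit of B: g ≠ 0, coprime integral, and supp(Bg) inclusion-minimal
-- among supports of { B z : z ≠ 0 }
IsCircuit : ∀ {m n} → Matrix m n → (Fin n → ℤ) → Set
IsCircuit {n = n} B g =
  NonZeroℤ g × CoprimeComponents g ×
  (∀ (z : Point n) → NonZeroℚ z →
     (∀ l → (B ⊛ z) l ≢ 0ℚ → (B ⊛ toℚᵛ g) l ≢ 0ℚ) →
     (∀ l → (B ⊛ toℚᵛ g) l ≢ 0ℚ → (B ⊛ z) l ≢ 0ℚ))

-- a walk is given by its start point and its list of steps (α_i , g^i);
-- y^{(i+1)} = y^{(i)} + α_i g^i
Step : ℕ → Set
Step n = ℚ × (Fin n → ℤ)

CircuitWalk : ∀ {m n} → Matrix m n → Point n → List (Step n) → Point n → Set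
CircuitWalk B y [] t = y ≈ t
CircuitWalk B y ((α , g) ∷ s) t =
  0ℚ < α × IsCircuit B g × CircuitWalk B (y ⊕ (α ⊙ toℚᵛ g)) s t

Feasible : ∀ {m n} → Matrix m n → Point m → Point n → List (Step n) → Set
Feasible B d y [] = InP B d y
Feasible B d y ((α , g) ∷ s) = InP B d y × Feasible B d (y ⊕ (α ⊙ toℚᵛ g)) s

Maximal : ∀ {m n} → Matrix m n → Point m → Point n → List (Step n) → Set
Maximal B d y [] = ⊤
Maximal B d y ((α , g) ∷ s) =
  (∀ β → α < β → ¬ InP B d (y ⊕ (β ⊙ toℚᵛ g))) × Maximal B d (y ⊕ (α ⊙ toℚᵛ g)) s

EdgeWalk : ∀ {m n} → Matrix m n → Point m → Point n → List (Step n) → Set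
EdgeWalk B d y [] = ⊤
EdgeWalk B d y ((α , g) ∷ s) =
  Adjacent B d y (y ⊕ (α ⊙ toℚᵛ g)) × EdgeWalk B d (y ⊕ (α ⊙ toℚᵛ g)) s

SignCompatible : ∀ {m n} → Matrix m n → Point n → Point n → List (Step n) → Set
SignCompatible B v₁ v₂ s =
  ∀ {p q : Step _} → p ∈ s → q ∈ s → ∀ l →
    (0ℚ ≤ (B ⊛ toℚᵛ (proj₂ p)) l * (B ⊛ toℚᵛ (proj₂ q)) l) ×
    (0ℚ ≤ (B ⊛ toℚᵛ (proj₂ p)) l * (B ⊛ (v₂ ⊖ v₁)) l)

-- P = {z ≥ 0, 2z₀ + z₁ ≤ 3, z₀ + 2z₁ ≤ 3} with v⁽¹⁾ = (0,0) and v⁽²⁾ = (1,1).  Sign-compatibility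
-- with v⁽²⁾ − v⁽¹⁾ forces every step direction into the nonnegative quadrant, so the coordinates
-- of a walk never decrease and no point of it exceeds (1,1).  The only circuits in the closed
-- quadrant are the axis directions, since a direction with two positive coordinates has full
-- support under B.  The first step therefore runs from the origin along an axis to a point at
-- distance at most 1, although the edge of P on that axis is 3/2 long: it is not maximal.
module Submission where

open import Defs
open import Data.Nat using (ℕ; zero; suc)
open import Data.Rational using (ℚ; 0ℚ; 1ℚ; _+_; _*_; _-_; -_; _≤_; _<_; _<?_; _/_; nonNegative; positive)
open import Data.Rational.Properties
open import Data.Rational.Solver using (module +-*-Solver)
import Data.Integer as ℤ
open import Data.Fin using (Fin; zero; suc; _↑ˡ_; _↑ʳ_)
open import Data.List using (List; []; _∷_)
open import Data.List.Membership.Propositional using (_∈_)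
open import Data.List.Relation.Unary.Any using (here; there)
open import Data.Product using (Σ; ∃; _×_; _,_; proj₂)
open import Data.Sum as ⊎ using (_⊎_; inj₁; inj₂)
open import Data.Empty using (⊥; ⊥-elim)
open import Function using (_∘_)
open import Relation.Binary using (tri<; tri≈; tri>)
open import Relation.Binary.PropositionalEquality using (_≡_; _≢_; refl; sym; trans; cong; cong₂; subst; module ≡-Reasoning)
open import Relation.Nullary using (¬_)
open import Relation.Nullary.Decidable using (toWitness)

open +-*-Solver

0≤p*q : ∀ {p q} → 0ℚ ≤ p → 0ℚ ≤ q → 0ℚ ≤ p * q
0≤p*q {p} {q} 0≤p 0≤q =
  nonNegative⁻¹ (p * q) {{nonNeg*nonNeg⇒nonNeg p {{nonNegative 0≤p}} q {{nonNegative 0≤q}}}}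

p≤q⇒0≤q-p : ∀ {p q} → p ≤ q → 0ℚ ≤ q - p
p≤q⇒0≤q-p {p} {q} p≤q = subst (_≤ q - p) (+-inverseʳ p) (+-monoˡ-≤ (- p) p≤q)

p≤p+q : ∀ {p q} → 0ℚ ≤ q → p ≤ p + q
p≤p+q {p} {q} 0≤q = subst (_≤ p + q) (+-identityʳ p) (+-monoʳ-≤ p 0≤q)

0<p⇒p≢0 : ∀ {p} → 0ℚ < p → p ≢ 0ℚ
0<p⇒p≢0 0<p = <⇒≢ 0<p ∘ sym

≤⇒<⊎≡ : ∀ {p q} → p ≤ q → p < q ⊎ p ≡ q
≤⇒<⊎≡ {p} {q} p≤q with <-cmp p q
... | tri< p<q _ _ = inj₁ p<q
... | tri≈ _ p≡q _ = inj₂ p≡q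
... | tri> _ _ q<p = ⊥-elim (<-irrefl refl (≤-<-trans p≤q q<p))

one-vanishes⇒+≤ : ∀ {p q r} → p ≡ 0ℚ ⊎ q ≡ 0ℚ → p ≤ r → q ≤ r → p + q ≤ r
one-vanishes⇒+≤ {q = q} (inj₁ refl) _ q≤r = subst (_≤ _) (sym (+-identityˡ q)) q≤r
one-vanishes⇒+≤ {p = p} (inj₂ refl) p≤r _ = subst (_≤ _) (sym (+-identityʳ p)) p≤r

Σᶠ-cong : ∀ {n} {f g : Fin n → ℚ} → (∀ i → f i ≡ g i) → Σᶠ f ≡ Σᶠ g
Σᶠ-cong {zero}  f≗g = refl
Σᶠ-cong {suc n} f≗g = cong₂ _+_ (f≗g zero) (Σᶠ-cong (f≗g ∘ suc))

Σᶠ-linear : ∀ {n} a b (f g : Fin n → ℚ) →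
            Σᶠ (λ i → a * f i + b * g i) ≡ a * Σᶠ f + b * Σᶠ g
Σᶠ-linear {zero} a b f g = solve 2 (λ a b → con 0ℚ := a :* con 0ℚ :+ b :* con 0ℚ) refl a b
Σᶠ-linear {suc n} a b f g = begin
  (a * f zero + b * g zero) + Σᶠ (λ i → a * f (suc i) + b * g (suc i))
    ≡⟨ cong ((a * f zero + b * g zero) +_) (Σᶠ-linear a b (f ∘ suc) (g ∘ suc)) ⟩
  (a * f zero + b * g zero) + (a * Σᶠ (f ∘ suc) + b * Σᶠ (g ∘ suc))
    ≡⟨ solve 6 (λ a b x y X Y → (a :* x :+ b :* y) :+ (a :* X :+ b :* Y) :=
                                a :* (x :+ X) :+ b :* (y :+ Y))
             refl a b (f zero) (g zero) (Σᶠ (f ∘ suc)) (Σᶠ (g ∘ suc)) ⟩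
  a * (f zero + Σᶠ (f ∘ suc)) + b * (g zero + Σᶠ (g ∘ suc)) ∎
  where open ≡-Reasoning

⊛-cong : ∀ {m n} (M : Matrix m n) {x y : Point n} → x ≈ y → ∀ l → (M ⊛ x) l ≡ (M ⊛ y) l
⊛-cong M x≈y l = Σᶠ-cong (λ i → cong (M l i *_) (x≈y i))

⊛-linear : ∀ {m n} (M : Matrix m n) a b (x y : Point n) l →
           (M ⊛ ((a ⊙ x) ⊕ (b ⊙ y))) l ≡ a * (M ⊛ x) l + b * (M ⊛ y) l
⊛-linear M a b x y l =
  trans (Σᶠ-cong (λ i → solve 5 (λ m a b x y → m :* (a :* x :+ b :* y) :=
                                               a :* (m :* x) :+ b :* (m :* y))
                               refl (M l i) a b (x i) (y i)))
        (Σᶠ-linear a b (λ i → M l i * x i) (λ i → M l i * y i))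

convex-tight : ∀ {t u w c} → 0ℚ < t → t < 1ℚ → u ≤ c → w ≤ c →
               t * u + (1ℚ - t) * w ≡ c → u ≡ c
convex-tight {t} {u} {w} {c} 0<t t<1 u≤c w≤c mean≡c = ≤-antisym u≤c (≮⇒≥ u≮c)
  where
  open ≤-Reasoning
  u≮c : ¬ u < c
  u≮c u<c = <-irrefl mean≡c (begin-strict
    t * u + (1ℚ - t) * w
      <⟨ +-mono-<-≤ (*-monoʳ-<-pos t {{positive 0<t}} u<c)
                    (*-monoˡ-≤-nonNeg (1ℚ - t) {{nonNegative (p≤q⇒0≤q-p (<⇒≤ t<1))}} w≤c) ⟩
    t * c + (1ℚ - t) * c
      ≡⟨ solve 2 (λ t c → t :* c :+ (con 1ℚ :- t) :* c := c) refl t c ⟩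
    c ∎)

unique-on-tight-rows⇒IsVertex :
  ∀ {m n k} (B : Matrix m n) (d : Point m) (v : Point n) (row : Fin k → Fin m) →
  InP B d v → (∀ j → (B ⊛ v) (row j) ≡ d (row j)) →
  (∀ z → (∀ j → (B ⊛ z) (row j) ≡ d (row j)) → z ≈ v) →
  IsVertex B d v
unique-on-tight-rows⇒IsVertex B d v row v∈P v-tight unique =
  v∈P , λ x y t x∈P y∈P 0<t t<1 v≈xy → unique x (λ j →
    convex-tight 0<t t<1 (x∈P (row j)) (y∈P (row j)) (begin
      t * (B ⊛ x) (row j) + (1ℚ - t) * (B ⊛ y) (row j)
        ≡⟨ sym (⊛-linear B t (1ℚ - t) x y (row j)) ⟩
      (B ⊛ ((t ⊙ x) ⊕ ((1ℚ - t) ⊙ y))) (row j)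
        ≡⟨ sym (⊛-cong B v≈xy (row j)) ⟩
      (B ⊛ v) (row j)
        ≡⟨ v-tight j ⟩
      d (row j) ∎))
  where open ≡-Reasoning

circuitWalk-monotone :
  ∀ {m n} {B : Matrix m n} (i : Fin n) {y t : Point n} (s : List (Step n)) →
  (∀ {p} → p ∈ s → 0ℚ ≤ toℚᵛ (proj₂ p) i) → CircuitWalk B y s t → y i ≤ t i
circuitWalk-monotone i [] nonneg y≈t = ≤-reflexive (y≈t i)
circuitWalk-monotone i {y} {t} ((α , g) ∷ s) nonneg (0<α , _ , walk) = begin
  y i                 ≤⟨ p≤p+q (0≤p*q (<⇒≤ 0<α) (nonneg (here refl))) ⟩
  y i + α * toℚᵛ g i  ≤⟨ circuitWalk-monotone i s (nonneg ∘ there) walk ⟩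
  t i                 ∎
  where open ≤-Reasoning

2ℚ 3ℚ 3/2 : ℚ
2ℚ  = ℤ.+ 2 / 1
3ℚ  = ℤ.+ 3 / 1
3/2 = ℤ.+ 3 / 2

B₀ : Matrix 4 2
B₀ zero                   zero       = - 1ℚ
B₀ zero                   (suc zero) = 0ℚ
B₀ (suc zero)             zero       = 0ℚ
B₀ (suc zero)             (suc zero) = - 1ℚ
B₀ (suc (suc zero))       zero       = 2ℚ
B₀ (suc (suc zero))       (suc zero) = 1ℚ
B₀ (suc (suc (suc zero))) zero       = 1ℚ
B₀ (suc (suc (suc zero))) (suc zero) = 2ℚ

d₀ : Point 4
d₀ zero                   = 0ℚ
d₀ (suc zero)             = 0ℚ
d₀ (suc (suc zero))       = 3ℚ
d₀ (suc (suc (suc zero))) = 3ℚ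

origin ones : Point 2
origin _ = 0ℚ
ones   _ = 1ℚ

B₀-sign-row : ∀ (z : Point 2) i → (B₀ ⊛ z) (i ↑ˡ 2) ≡ - z i
B₀-sign-row z zero =
  solve 2 (λ a b → con (- 1ℚ) :* a :+ (con 0ℚ :* b :+ con 0ℚ) := :- a) refl (z zero) (z (suc zero))
B₀-sign-row z (suc zero) =
  solve 2 (λ a b → con 0ℚ :* a :+ (con (- 1ℚ) :* b :+ con 0ℚ) := :- b) refl (z zero) (z (suc zero))

B₀-row₂ : ∀ (z : Point 2) → (B₀ ⊛ z) (2 ↑ʳ zero) ≡ 2ℚ * z zero + z (suc zero)
B₀-row₂ z =
  solve 2 (λ a b → con 2ℚ :* a :+ (con 1ℚ :* b :+ con 0ℚ) := con 2ℚ :* a :+ b) refl (z zero) (z (suc zero))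

B₀-row₃ : ∀ (z : Point 2) → (B₀ ⊛ z) (2 ↑ʳ suc zero) ≡ z zero + 2ℚ * z (suc zero)
B₀-row₃ z =
  solve 2 (λ a b → con 1ℚ :* a :+ (con 2ℚ :* b :+ con 0ℚ) := a :+ con 2ℚ :* b) refl (z zero) (z (suc zero))

∈P₀ : ∀ (z : Point 2) → 0ℚ ≤ z zero → 0ℚ ≤ z (suc zero) →
      2ℚ * z zero + z (suc zero) ≤ 3ℚ → z zero + 2ℚ * z (suc zero) ≤ 3ℚ → InP B₀ d₀ z
∈P₀ z z₀≥0 z₁≥0 row₂ row₃ zero =
  subst (_≤ 0ℚ) (sym (B₀-sign-row z zero)) (neg-antimono-≤ z₀≥0)
∈P₀ z z₀≥0 z₁≥0 row₂ row₃ (suc zero) =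
  subst (_≤ 0ℚ) (sym (B₀-sign-row z (suc zero))) (neg-antimono-≤ z₁≥0)
∈P₀ z z₀≥0 z₁≥0 row₂ row₃ (suc (suc zero))       = subst (_≤ 3ℚ) (sym (B₀-row₂ z)) row₂
∈P₀ z z₀≥0 z₁≥0 row₂ row₃ (suc (suc (suc zero))) = subst (_≤ 3ℚ) (sym (B₀-row₃ z)) row₃

P₀-nonneg : ∀ (z : Point 2) → InP B₀ d₀ z → ∀ i → 0ℚ ≤ z i
P₀-nonneg z z∈P i = subst (0ℚ ≤_) (solve 1 (λ a → :- (:- a) := a) refl (z i))
  (neg-antimono-≤ (subst (_≤ 0ℚ) (B₀-sign-row z i) (sign-row≤0 i)))
  where
  sign-row≤0 : ∀ i → (B₀ ⊛ z) (i ↑ˡ 2) ≤ 0ℚ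
  sign-row≤0 zero       = z∈P zero
  sign-row≤0 (suc zero) = z∈P (suc zero)

P₀-bounded : Bounded B₀ d₀
P₀-bounded = 3ℚ , λ z z∈P i →
  subst (_≤ 3ℚ) (sym (0≤p⇒∣p∣≡p (P₀-nonneg z z∈P i))) (coordinate≤3 z z∈P i)
  where
  open ≤-Reasoning
  coordinate≤3 : ∀ z → InP B₀ d₀ z → ∀ i → z i ≤ 3ℚ
  coordinate≤3 z z∈P zero = begin
    z zero                            ≤⟨ p≤p+q (+-mono-≤ (P₀-nonneg z z∈P zero) (P₀-nonneg z z∈P (suc zero))) ⟩
    z zero + (z zero + z (suc zero))  ≡⟨ solve 2 (λ a b → a :+ (a :+ b) := con 2ℚ :* a :+ b)
                                                 refl (z zero) (z (suc zero)) ⟩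
    2ℚ * z zero + z (suc zero)        ≡⟨ B₀-row₂ z ⟨
    (B₀ ⊛ z) (2 ↑ʳ zero)              ≤⟨ z∈P (2 ↑ʳ zero) ⟩
    3ℚ                                ∎
  coordinate≤3 z z∈P (suc zero) = begin
    z (suc zero)                            ≤⟨ p≤p+q (+-mono-≤ (P₀-nonneg z z∈P zero) (P₀-nonneg z z∈P (suc zero))) ⟩
    z (suc zero) + (z zero + z (suc zero))  ≡⟨ solve 2 (λ a b → b :+ (a :+ b) := a :+ con 2ℚ :* b)
                                                       refl (z zero) (z (suc zero)) ⟩
    z zero + 2ℚ * z (suc zero)              ≡⟨ B₀-row₃ z ⟨
    (B₀ ⊛ z) (2 ↑ʳ suc zero)                ≤⟨ z∈P (2 ↑ʳ suc zero) ⟩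
    3ℚ                                      ∎

triangle⊆P₀ : ∀ (z : Point 2) → 0ℚ ≤ z zero → 0ℚ ≤ z (suc zero) →
              z zero + z (suc zero) ≤ 3/2 → InP B₀ d₀ z
triangle⊆P₀ z z₀≥0 z₁≥0 sum≤3/2 =
  ∈P₀ z z₀≥0 z₁≥0 (double+≤3 (z zero) z₁≥0 sum≤3/2)
      (subst (_≤ 3ℚ) (+-comm (2ℚ * z (suc zero)) (z zero))
             (double+≤3 (z (suc zero)) z₀≥0 (subst (_≤ 3/2) (+-comm (z zero) (z (suc zero))) sum≤3/2)))
  where
  open ≤-Reasoning
  double+≤3 : ∀ a {b} → 0ℚ ≤ b → a + b ≤ 3/2 → 2ℚ * a + b ≤ 3ℚ
  double+≤3 a {b} b≥0 a+b≤3/2 = begin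
    2ℚ * a + b      ≤⟨ p≤p+q b≥0 ⟩
    2ℚ * a + b + b  ≡⟨ solve 2 (λ a b → con 2ℚ :* a :+ b :+ b := con 2ℚ :* (a :+ b)) refl a b ⟩
    2ℚ * (a + b)    ≤⟨ *-monoˡ-≤-nonNeg 2ℚ a+b≤3/2 ⟩
    2ℚ * 3/2        ≡⟨⟩
    3ℚ              ∎

origin-vertex : IsVertex B₀ d₀ origin
origin-vertex = unique-on-tight-rows⇒IsVertex {k = 2} B₀ d₀ origin (_↑ˡ 2)
  (triangle⊆P₀ origin ≤-refl ≤-refl (≤ᵇ⇒≤ _))
  (λ { zero → refl ; (suc zero) → refl })
  (λ z tight → λ { zero       → neg-injective (trans (sym (B₀-sign-row z zero)) (tight zero))
                 ; (suc zero) → neg-injective (trans (sym (B₀-sign-row z (suc zero))) (tight (suc zero))) })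

ones-vertex : IsVertex B₀ d₀ ones
ones-vertex = unique-on-tight-rows⇒IsVertex {k = 2} B₀ d₀ ones (2 ↑ʳ_)
  (∈P₀ ones (≤ᵇ⇒≤ _) (≤ᵇ⇒≤ _) (≤ᵇ⇒≤ _) (≤ᵇ⇒≤ _))
  (λ { zero → refl ; (suc zero) → refl })
  solution
  where
  solution : ∀ z → (∀ j → (B₀ ⊛ z) (2 ↑ʳ j) ≡ d₀ (2 ↑ʳ j)) → z ≈ ones
  solution z tight = λ
    { zero       → trans (solve 2 (λ a b → a := con (ℤ.+ 1 / 3) :* (con 2ℚ :* (con 2ℚ :* a :+ b) :- (a :+ con 2ℚ :* b)))
                                  refl (z zero) (z (suc zero)))
                         (cong₂ (λ p q → ℤ.+ 1 / 3 * (2ℚ * p - q)) row₂ row₃)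
    ; (suc zero) → trans (solve 2 (λ a b → b := con (ℤ.+ 1 / 3) :* (con 2ℚ :* (a :+ con 2ℚ :* b) :- (con 2ℚ :* a :+ b)))
                                  refl (z zero) (z (suc zero)))
                         (cong₂ (λ p q → ℤ.+ 1 / 3 * (2ℚ * p - q)) row₃ row₂) }
    where
    row₂ : 2ℚ * z zero + z (suc zero) ≡ 3ℚ
    row₂ = trans (sym (B₀-row₂ z)) (tight zero)
    row₃ : z zero + 2ℚ * z (suc zero) ≡ 3ℚ
    row₃ = trans (sym (B₀-row₃ z)) (tight (suc zero))

signCompatible⇒nonneg : ∀ {s} → SignCompatible B₀ origin ones s →
                        ∀ {p} → p ∈ s → ∀ i → 0ℚ ≤ toℚᵛ (proj₂ p) i
signCompatible⇒nonneg sc {_ , g} p∈s i =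
  subst (0ℚ ≤_) sign-product≡gᵢ (proj₂ (sc p∈s p∈s (i ↑ˡ 2)))
  where
  sign-product≡gᵢ : (B₀ ⊛ toℚᵛ g) (i ↑ˡ 2) * (B₀ ⊛ (ones ⊖ origin)) (i ↑ˡ 2) ≡ toℚᵛ g i
  sign-product≡gᵢ =
    trans (cong₂ _*_ (B₀-sign-row (toℚᵛ g) i) (B₀-sign-row (ones ⊖ origin) i))
          (solve 1 (λ a → :- a :* con (- 1ℚ) := a) refl (toℚᵛ g i))

e₀ : Point 2
e₀ zero       = 1ℚ
e₀ (suc zero) = 0ℚ

-- B₀ g has full support, which strictly contains the support of B₀ e₀.
positive-direction-not-circuit : ∀ {g} → IsCircuit B₀ g →
  0ℚ < toℚᵛ g zero → 0ℚ < toℚᵛ g (suc zero) → ⊥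
positive-direction-not-circuit {g} (_ , _ , minimal) g₀>0 g₁>0 =
  minimal e₀ (λ e₀≡0 → 1≢0 (e₀≡0 zero)) (λ l _ → full-support l) (suc zero) (full-support (suc zero)) refl
  where
  full-support : ∀ l → (B₀ ⊛ toℚᵛ g) l ≢ 0ℚ
  full-support zero = <⇒≢ (neg-antimono-< g₀>0) ∘ trans (sym (B₀-sign-row (toℚᵛ g) zero))
  full-support (suc zero) = <⇒≢ (neg-antimono-< g₁>0) ∘ trans (sym (B₀-sign-row (toℚᵛ g) (suc zero)))
  full-support (suc (suc zero)) = subst (_≢ 0ℚ) (sym (B₀-row₂ (toℚᵛ g)))
    (0<p⇒p≢0 (+-mono-< (*-monoʳ-<-pos 2ℚ g₀>0) g₁>0))
  full-support (suc (suc (suc zero))) = subst (_≢ 0ℚ) (sym (B₀-row₃ (toℚᵛ g)))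
    (0<p⇒p≢0 (+-mono-< g₀>0 (*-monoʳ-<-pos 2ℚ g₁>0)))

nonneg-circuit-on-axis : ∀ {g} → IsCircuit B₀ g → (∀ i → 0ℚ ≤ toℚᵛ g i) →
                         toℚᵛ g zero ≡ 0ℚ ⊎ toℚᵛ g (suc zero) ≡ 0ℚ
nonneg-circuit-on-axis g-circuit g≥0 with ≤⇒<⊎≡ (g≥0 zero) | ≤⇒<⊎≡ (g≥0 (suc zero))
... | inj₂ 0≡g₀ | _         = inj₁ (sym 0≡g₀)
... | inj₁ _    | inj₂ 0≡g₁ = inj₂ (sym 0≡g₁)
... | inj₁ g₀>0 | inj₁ g₁>0 = ⊥-elim (positive-direction-not-circuit g-circuit g₀>0 g₁>0)

stretched-axis-step∈P₀ : ∀ {α} (w : Point 2) → 0ℚ ≤ α → (∀ i → 0ℚ ≤ w i) →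
                         w zero ≡ 0ℚ ⊎ w (suc zero) ≡ 0ℚ → (∀ i → (origin ⊕ (α ⊙ w)) i ≤ 1ℚ) →
                         InP B₀ d₀ (origin ⊕ ((3/2 * α) ⊙ w))
stretched-axis-step∈P₀ {α} w α≥0 w≥0 on-axis y≤1 =
  triangle⊆P₀ z (z≥0 zero) (z≥0 (suc zero)) (begin
    z zero + z (suc zero)
      ≡⟨ solve 3 (λ a x y → (con 0ℚ :+ con 3/2 :* a :* x) :+ (con 0ℚ :+ con 3/2 :* a :* y) :=
                            con 3/2 :* ((con 0ℚ :+ a :* x) :+ (con 0ℚ :+ a :* y)))
               refl α (w zero) (w (suc zero)) ⟩
    3/2 * (y zero + y (suc zero))
      ≤⟨ *-monoˡ-≤-nonNeg 3/2 (one-vanishes⇒+≤ (⊎.map (y-vanishes zero) (y-vanishes (suc zero)) on-axis)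
                                               (y≤1 zero) (y≤1 (suc zero))) ⟩
    3/2 * 1ℚ
      ≡⟨⟩
    3/2 ∎)
  where
  open ≤-Reasoning
  y z : Point 2
  y = origin ⊕ (α ⊙ w)
  z = origin ⊕ ((3/2 * α) ⊙ w)

  z≥0 : ∀ i → 0ℚ ≤ z i
  z≥0 i = p≤p+q (0≤p*q (*-monoˡ-≤-nonNeg 3/2 α≥0) (w≥0 i))

  y-vanishes : ∀ i → w i ≡ 0ℚ → y i ≡ 0ℚ
  y-vanishes i wᵢ≡0 = trans (cong (λ x → 0ℚ + α * x) wᵢ≡0)
                            (solve 1 (λ a → con 0ℚ :+ a :* con 0ℚ := con 0ℚ) refl α)

no-maximal-signCompatible-walk :
  ¬ (∃ λ (s : List (Step 2)) →
       CircuitWalk B₀ origin s ones × Feasible B₀ d₀ origin s × Maximal B₀ d₀ origin s ×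
       SignCompatible B₀ origin ones s)
no-maximal-signCompatible-walk ([] , origin≈ones , _) = 1≢0 (sym (origin≈ones zero))
no-maximal-signCompatible-walk ((α , g) ∷ s , (0<α , g-circuit , walk) , _ , (maximal , _) , sc) =
  maximal (3/2 * α) α<3/2*α
    (stretched-axis-step∈P₀ (toℚᵛ g) (<⇒≤ 0<α) g≥0 (nonneg-circuit-on-axis g-circuit g≥0) y≤1)
  where
  g≥0 : ∀ i → 0ℚ ≤ toℚᵛ g i
  g≥0 = signCompatible⇒nonneg sc (here refl)

  y≤1 : ∀ i → (origin ⊕ (α ⊙ toℚᵛ g)) i ≤ 1ℚ
  y≤1 i = circuitWalk-monotone i s (λ p∈s → signCompatible⇒nonneg sc (there p∈s) i) walk

  α<3/2*α : α < 3/2 * α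
  α<3/2*α = subst (_< 3/2 * α) (*-identityˡ α)
                  (*-monoˡ-<-pos α {{positive 0<α}} (toWitness {a? = 1ℚ <? 3/2} _))

lemma1 : Σ ℕ λ m → Σ (Matrix m 2) λ B → Σ (Point m) λ d →
           Bounded B d ×
           (Σ (Point 2) λ v₁ → Σ (Point 2) λ v₂ →
             IsVertex B d v₁ × IsVertex B d v₂ ×
             (¬ (∃ λ (s : List (Step 2)) →
                   CircuitWalk B v₁ s v₂ × Feasible B d v₁ s × Maximal B d v₁ s ×
                   SignCompatible B v₁ v₂ s)) ×
             (¬ (∃ λ (s : List (Step 2)) →
                   CircuitWalk B v₁ s v₂ × EdgeWalk B d v₁ s × Feasible B d v₁ s ×
                   Maximal B d v₁ s × SignCompatible B v₁ v₂ s)))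
lemma1 =
  4 , B₀ , d₀ , P₀-bounded , origin , ones , origin-vertex , ones-vertex ,
  no-maximal-signCompatible-walk ,
  λ (s , walk , _ , feasible , maximal , sc) →
    no-maximal-signCompatible-walk (s , walk , feasible , maximal , sc)
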